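{- Let $A$ be a finite alphabet, let $S\subseteq A^*$ be a neutral set, let $X$ be a finite $S$-maximal suffix code and let $Y$ be a finite $S$-maximal prefix code. Then $m_S^{X,Y}(w)=m_S(w)$ for every $w\in S$.
   Context: A set $S\subseteq A^*$ is factorial if it contains all factors of its elements. For $w\in S$: $\ell_S(w)=\mathrm{Card}\{a\in A: aw\in S\}$, $r_S(w)=\mathrm{Card}\{a\in A: wa\in S\}$, $e_S(w)=\mathrm{Card}\{(a,b)\in A\times A: awb\in S\}$, $m_S(w)=e_S(w)-\ell_S(w)-r_S(w)+1$. $S$ is neutral if it is factorial and $m_S(w)=0$ for every nonempty $w\in S$. For sets of words $X,Y$ and $w\in S$: $\ell_S^X(w)=\mathrm{Card}\{x\in X: xw\in S\}$, $r_S^Y(w)=\mathrm{Card}\{y\in Y: wy\in S\}$, $e_S^{X,Y}(w)=\mathrm{Card}\{(x,y)\in X\times Y: xwy\in S\}$, and $m_S^{X,Y}(w)=e_S^{X,Y}(w)-\ell_S^X(w)-r_S^Y(w)+1$. A prefix (resp. suffix) code is a set of nonempty words none of which is a proper prefix (resp. suffix) of another; a prefix (resp. suffix) code $Z\subseteq S$ is $S$-maximal if it is not properly contained in a prefix (resp. suffix) code contained in $S$. -}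

module Defs where

open import Data.Nat using (ℕ; zero; suc)
open import Data.Integer using (ℤ; +_; _+_; _-_)
open import Data.Fin using (Fin)
open import Data.List using (List; []; _∷_; _++_; allFin; cartesianProduct)
open import Data.List.Membership.Propositional using (_∈_; _∉_)
open import Data.List.Relation.Unary.Unique.Propositional using (Unique)
open import Data.Bool using (Bool; true; false)
open import Data.Product using (Σ; _×_; _,_; ∃)
open import Relation.Nullary using (¬_)
open import Relation.Binary.PropositionalEquality using (_≡_; _≢_)

-- Convention: the finite alphabet is A = Fin n; a word is a List (Fin n);
-- a (possibly infinite) set of words is a Bool-valued predicate on words;
-- a finite set of words is a duplicate-free list of words.

Word : ℕ → Set
Word n = List (Fin n)

Lang : ℕ → Set
Lang n = Word n → Bool

count : {B : Set} → (B → Bool) → List B → ℕ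
count p [] = zero
count p (b ∷ bs) with p b
... | true  = suc (count p bs)
... | false = count p bs

module _ {n : ℕ} where

  ℓ : Lang n → Word n → ℕ
  ℓ S w = count (λ a → S (a ∷ w)) (allFin n)

  r : Lang n → Word n → ℕ
  r S w = count (λ a → S (w ++ (a ∷ []))) (allFin n)

  e : Lang n → Word n → ℕ
  e S w = count (λ ab → S (Data.Product.proj₁ ab ∷ w ++ (Data.Product.proj₂ ab ∷ [])))
                (cartesianProduct (allFin n) (allFin n))

  m : Lang n → Word n → ℤ
  m S w = ((+ e S w - + ℓ S w) - + r S w) + + 1

  ℓX : Lang n → List (Word n) → Word n → ℕ
  ℓX S X w = count (λ x → S (x ++ w)) X

  rY : Lang n → List (Word n) → Word n → ℕ
  rY S Y w = count (λ y → S (w ++ y)) Y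

  eXY : Lang n → List (Word n) → List (Word n) → Word n → ℕ
  eXY S X Y w = count (λ xy → S (Data.Product.proj₁ xy ++ w ++ Data.Product.proj₂ xy))
                      (cartesianProduct X Y)

  mXY : Lang n → List (Word n) → List (Word n) → Word n → ℤ
  mXY S X Y w = ((+ eXY S X Y w - + ℓX S X w) - + rY S Y w) + + 1

  Factorial : Lang n → Set
  Factorial S = ∀ (u v w : Word n) → S (u ++ v ++ w) ≡ true → S v ≡ true

  Neutral : Lang n → Set
  Neutral S = Factorial S × (∀ (w : Word n) → w ≢ [] → S w ≡ true → m S w ≡ + 0)

  ProperPrefix : Word n → Word n → Set
  ProperPrefix x y = ∃ λ (u : Word n) → u ≢ [] × x ++ u ≡ y

  ProperSuffix : Word n → Word n → Set
  ProperSuffix x y = ∃ λ (u : Word n) → u ≢ [] × u ++ x ≡ y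

  IsPrefixCode : (Word n → Set) → Set
  IsPrefixCode P = (∀ x → P x → x ≢ []) × (∀ x y → P x → P y → ¬ ProperPrefix x y)

  IsSuffixCode : (Word n → Set) → Set
  IsSuffixCode P = (∀ x → P x → x ≢ []) × (∀ x y → P x → P y → ¬ ProperSuffix x y)

  InList : List (Word n) → Word n → Set
  InList Z x = x ∈ Z

  InLang : Lang n → Word n → Set
  InLang Z x = Z x ≡ true

  SMaximalPrefixCode : Lang n → List (Word n) → Set
  SMaximalPrefixCode S Z =
    IsPrefixCode (InList Z) × (∀ z → z ∈ Z → S z ≡ true) ×
    (∀ (Z' : Lang n) → IsPrefixCode (InLang Z') → (∀ z → Z' z ≡ true → S z ≡ true) →
       (∀ z → z ∈ Z → Z' z ≡ true) → ¬ (∃ λ z → Z' z ≡ true × z ∉ Z))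

  SMaximalSuffixCode : Lang n → List (Word n) → Set
  SMaximalSuffixCode S Z =
    IsSuffixCode (InList Z) × (∀ z → z ∈ Z → S z ≡ true) ×
    (∀ (Z' : Lang n) → IsSuffixCode (InLang Z') → (∀ z → Z' z ≡ true → S z ≡ true) →
       (∀ z → z ∈ Z → Z' z ≡ true) → ¬ (∃ λ z → Z' z ≡ true × z ∉ Z))

module Submission where

-- Put D_Y(u) = ∑_{y ∈ Y} [uy ∈ S] − [u ∈ S] and M_{X,Y}(w) = ∑_{x ∈ X} D_Y(xw) − D_Y(w).
-- On S, M_{X,Y} = m^{X,Y}_S, and M_{A,A} = m_S for the alphabet A (as one-letter words).
-- Splitting an ε-free Y by first letters gives  M_{X,Y}(w) = ∑_a M_{X,a⁻¹Y}(wa) + M_{X,A}(w).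
-- If M_{X,A} vanishes at nonempty words and Y is a prefix code meeting every word of S
-- (which is what S-maximality provides), induction on the length of the words of Y
-- kills every term M_{X,a⁻¹Y}(wa): this is right invariance, M_{X,Y} = M_{X,A}.
-- Reversal of words exchanges prefix and suffix codes and gives left invariance.
-- Neutrality makes M_{A,A} vanish at nonempty words; left invariance then gives
-- m^{X,A}_S = m_S, and right invariance gives m^{X,Y}_S = m^{X,A}_S = m_S.

open import Defs
open import Data.Nat using (ℕ)
open import Data.List using (List)
open import Data.List.Relation.Unary.Unique.Propositional using (Unique)
open import Data.Bool using (true)
open import Relation.Binary.PropositionalEquality using (_≡_)

open import Data.Nat using (zero; suc; _≤_; s≤s)
open import Data.Nat.Properties using (m≤n⇒m≤1+n)
open import Data.Integer using (ℤ; +_; _+_; _-_)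
open import Data.Integer.Properties using (+-identityˡ; +-identityʳ; +-assoc; +-inverseʳ; +-minus-telescope)
open import Data.Integer.Tactic.RingSolver using (solve-∀)
open import Data.Fin using (Fin; zero; suc; _≟_)
open import Data.Fin.Properties using (suc-injective)
open import Data.List using ([]; _∷_; _++_; allFin; cartesianProduct; map; reverse; tabulate; length)
open import Data.List.Properties
  using (++-assoc; ++-identityʳ; ++-identityʳ-unique; ∷-injective; map-tabulate; map-∘; ≡-dec;
         reverse-++; reverse-involutive; reverse-injective)
open import Data.List.Membership.Propositional using (_∈_; _∉_; find; lose)
open import Data.List.Membership.Propositional.Properties using (∈-map⁺; ∈-map⁻)
open import Data.List.Relation.Unary.Any using (Any; here; there; any?)
open import Data.List.Relation.Unary.All as All using (All)
open import Data.List.Relation.Unary.AllPairs using ([]; _∷_)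
open import Data.List.Extrema.Nat using (argmax; f[xs]≤f[argmax])
import Data.List.Relation.Unary.Unique.Propositional.Properties as Unique
open import Data.Bool using (Bool; false)
open import Data.Bool.Properties using (¬-not) renaming (_≟_ to _≟ᵇ_)
open import Data.Empty using (⊥-elim)
open import Data.Sum using (_⊎_; inj₁; inj₂)
open import Data.Product using (_×_; _,_; ∃; proj₁; proj₂)
open import Function using (_∘_)
open import Relation.Nullary using (¬_; Dec; yes; no; does)
open import Relation.Nullary.Decidable using (dec-true)
open import Relation.Binary.PropositionalEquality using (_≢_; refl; sym; trans; cong; cong₂; subst; module ≡-Reasoning)

open ≡-Reasoning

χ : Bool → ℤ
χ true  = + 1
χ false = + 0

∑ : {B : Set} → (B → ℤ) → List B → ℤ
∑ f []       = + 0
∑ f (b ∷ bs) = f b + ∑ f bs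

module _ {B : Set} where

  ∑-cong : {f g : B → ℤ} (xs : List B) → (∀ x → f x ≡ g x) → ∑ f xs ≡ ∑ g xs
  ∑-cong []       f≗g = refl
  ∑-cong (x ∷ xs) f≗g = cong₂ _+_ (f≗g x) (∑-cong xs f≗g)

  ∑-zero : {f : B → ℤ} (xs : List B) → (∀ x → f x ≡ + 0) → ∑ f xs ≡ + 0
  ∑-zero []       f≗0 = refl
  ∑-zero (x ∷ xs) f≗0 = cong₂ _+_ (f≗0 x) (∑-zero xs f≗0)

  ∑-distrib-+ : (f g : B → ℤ) (xs : List B) → ∑ (λ x → f x + g x) xs ≡ ∑ f xs + ∑ g xs
  ∑-distrib-+ f g []       = refl
  ∑-distrib-+ f g (x ∷ xs) =
    trans (cong (_+_ (f x + g x)) (∑-distrib-+ f g xs)) (interchange (f x) (g x) _ _)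
    where
    interchange : ∀ a b c d → (a + b) + (c + d) ≡ (a + c) + (b + d)
    interchange = solve-∀

  ∑-distrib-- : (f g : B → ℤ) (xs : List B) → ∑ (λ x → f x - g x) xs ≡ ∑ f xs - ∑ g xs
  ∑-distrib-- f g []       = refl
  ∑-distrib-- f g (x ∷ xs) =
    trans (cong (_+_ (f x - g x)) (∑-distrib-- f g xs)) (interchange (f x) (g x) _ _)
    where
    interchange : ∀ a b c d → (a - b) + (c - d) ≡ (a + c) - (b + d)
    interchange = solve-∀

  ∑-++ : (f : B → ℤ) (xs ys : List B) → ∑ f (xs ++ ys) ≡ ∑ f xs + ∑ f ys
  ∑-++ f []       ys = sym (+-identityˡ _)
  ∑-++ f (x ∷ xs) ys = trans (cong (_+_ (f x)) (∑-++ f xs ys)) (sym (+-assoc (f x) _ _))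

  ∑-map : {C : Set} (f : B → ℤ) (g : C → B) (xs : List C) → ∑ f (map g xs) ≡ ∑ (f ∘ g) xs
  ∑-map f g []       = refl
  ∑-map f g (x ∷ xs) = cong (_+_ (f (g x))) (∑-map f g xs)

∑-comm : {B C : Set} (f : B → C → ℤ) (xs : List B) (ys : List C) →
  ∑ (λ x → ∑ (f x) ys) xs ≡ ∑ (λ y → ∑ (λ x → f x y) xs) ys
∑-comm f []       ys = sym (∑-zero ys (λ _ → refl))
∑-comm f (x ∷ xs) ys = trans (cong (_+_ (∑ (f x) ys)) (∑-comm f xs ys))
                             (sym (∑-distrib-+ (f x) (λ y → ∑ (λ x′ → f x′ y) xs) ys))

count≡∑ : {B : Set} (p : B → Bool) (xs : List B) → + count p xs ≡ ∑ (χ ∘ p) xs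
count≡∑ p []       = refl
count≡∑ p (b ∷ bs) with p b
... | true  = cong (_+_ (+ 1)) (count≡∑ p bs)
... | false = trans (count≡∑ p bs) (sym (+-identityˡ _))

count-map : {B C : Set} (p : B → Bool) (q : C → Bool) (f : B → C) (xs : List B) →
  (∀ x → q (f x) ≡ p x) → + count q (map f xs) ≡ + count p xs
count-map p q f xs q∘f≗p = begin
  + count q (map f xs)   ≡⟨ count≡∑ q (map f xs) ⟩
  ∑ (χ ∘ q) (map f xs)   ≡⟨ ∑-map (χ ∘ q) f xs ⟩
  ∑ (χ ∘ q ∘ f) xs       ≡⟨ ∑-cong xs (cong χ ∘ q∘f≗p) ⟩
  ∑ (χ ∘ p) xs           ≡⟨ count≡∑ p xs ⟨
  + count p xs           ∎

count-cartesianProduct : {B C : Set} (p : B × C → Bool) (xs : List B) (ys : List C) →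
  + count p (cartesianProduct xs ys) ≡ ∑ (λ x → ∑ (λ y → χ (p (x , y))) ys) xs
count-cartesianProduct p []       ys = refl
count-cartesianProduct p (x ∷ xs) ys = begin
  + count p (map (x ,_) ys ++ cartesianProduct xs ys)
    ≡⟨ count≡∑ p (map (x ,_) ys ++ cartesianProduct xs ys) ⟩
  ∑ (χ ∘ p) (map (x ,_) ys ++ cartesianProduct xs ys)
    ≡⟨ ∑-++ (χ ∘ p) (map (x ,_) ys) _ ⟩
  ∑ (χ ∘ p) (map (x ,_) ys) + ∑ (χ ∘ p) (cartesianProduct xs ys)
    ≡⟨ cong₂ _+_ (∑-map (χ ∘ p) (x ,_) ys)
                 (trans (sym (count≡∑ p (cartesianProduct xs ys))) (count-cartesianProduct p xs ys)) ⟩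
  ∑ (λ y → χ (p (x , y))) ys + ∑ (λ x′ → ∑ (λ y → χ (p (x′ , y))) ys) xs ∎

∑-allFin-suc : ∀ {n} (f : Fin (suc n) → ℤ) → ∑ f (allFin (suc n)) ≡ f zero + ∑ (f ∘ suc) (allFin n)
∑-allFin-suc {n} f = cong (_+_ (f zero)) (begin
  ∑ f (tabulate suc)            ≡⟨ cong (∑ f) (sym (map-tabulate (λ i → i) suc)) ⟩
  ∑ f (map suc (allFin n))      ≡⟨ ∑-map f suc (allFin n) ⟩
  ∑ (f ∘ suc) (allFin n)        ∎)

∑-allFin-point : ∀ {n} (f : Fin n → ℤ) (b : Fin n) → (∀ a → a ≢ b → f a ≡ + 0) →
  ∑ f (allFin n) ≡ f b
∑-allFin-point {suc n} f zero    off = begin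
  ∑ f (allFin (suc n))                ≡⟨ ∑-allFin-suc f ⟩
  f zero + ∑ (f ∘ suc) (allFin n)     ≡⟨ cong (_+_ (f zero)) (∑-zero (allFin n) (λ a → off (suc a) λ ())) ⟩
  f zero + + 0                        ≡⟨ +-identityʳ (f zero) ⟩
  f zero                              ∎
∑-allFin-point {suc n} f (suc b) off = begin
  ∑ f (allFin (suc n))                ≡⟨ ∑-allFin-suc f ⟩
  f zero + ∑ (f ∘ suc) (allFin n)     ≡⟨ cong₂ _+_ (off zero λ ())
                                                   (∑-allFin-point (f ∘ suc) b (λ a a≢b → off (suc a) (a≢b ∘ suc-injective))) ⟩
  + 0 + f (suc b)                     ≡⟨ +-identityˡ _ ⟩
  f (suc b)                           ∎

module _ {n : ℕ} where

  open import Data.List.Membership.DecPropositional (≡-dec (_≟_ {n})) using (_∈?_)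

  letters : List (Word n)
  letters = map (_∷ []) (allFin n)

  -- D_Y(u) = ∑_{y ∈ Y} [uy ∈ S] − [u ∈ S], the right defect of u relative to Y.
  -- For Y = letters it is r_S(u) − 1 on S, so it measures right branching.
  rightDefect : Lang n → List (Word n) → Word n → ℤ
  rightDefect S Y u = ∑ (λ y → χ (S (u ++ y))) Y - χ (S u)

  -- ∑_{x ∈ X} D_Y(xw) − D_Y(w); on S this is m^{X,Y}_S(w) (see mXY≡defect).
  -- Unlike m^{X,Y}_S it is additive in the structure of Y, which drives the proof.
  defect : Lang n → List (Word n) → List (Word n) → Word n → ℤ
  defect S X Y w = ∑ (λ x → rightDefect S Y (x ++ w)) X - rightDefect S Y w

  -- Regrouping the counts of m^{X,Y}_S(w) along x ∈ X; the `+ 1' is [w ∈ S].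
  mXY≡defect : ∀ S X Y w → S w ≡ true → mXY S X Y w ≡ defect S X Y w
  mXY≡defect S X Y w w∈S = begin
    ((+ eXY S X Y w - + ℓX S X w) - + rY S Y w) + + 1
      ≡⟨ cong₂ (λ e l → ((e - l) - + rY S Y w) + + 1) e≡E (count≡∑ _ X) ⟩
    ((E - L) - + rY S Y w) + + 1
      ≡⟨ cong (λ r′ → ((E - L) - r′) + + 1) (count≡∑ _ Y) ⟩
    ((E - L) - R) + + 1
      ≡⟨ regroup E L R ⟩
    (E - L) - (R - χ true)
      ≡⟨ cong (λ b → (E - L) - (R - χ b)) (sym w∈S) ⟩
    (E - L) - rightDefect S Y w
      ≡⟨ cong (_- rightDefect S Y w) (sym (∑-distrib-- _ _ X)) ⟩
    defect S X Y w ∎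
    where
    E L R : ℤ
    E = ∑ (λ x → ∑ (λ y → χ (S ((x ++ w) ++ y))) Y) X
    L = ∑ (λ x → χ (S (x ++ w))) X
    R = ∑ (λ y → χ (S (w ++ y))) Y
    e≡E : + eXY S X Y w ≡ E
    e≡E = trans (count-cartesianProduct _ X Y)
                (∑-cong X λ x → ∑-cong Y λ y → cong (χ ∘ S) (sym (++-assoc x w y)))
    regroup : ∀ e l r → ((e - l) - r) + + 1 ≡ (e - l) - (r - + 1)
    regroup = solve-∀

  extensions-outside : ∀ (S : Lang n) → Factorial S → ∀ w → S w ≡ false → ∀ x y → S (x ++ w ++ y) ≡ false
  extensions-outside S fac w w∉S x y = ¬-not λ xwy∈S → true≢false (trans (sym (fac x w y xwy∈S)) w∉S)
    where
    true≢false : true ≢ false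
    true≢false ()

  rightDefect-outside : ∀ (S : Lang n) → Factorial S → ∀ Y w → S w ≡ false → ∀ x → rightDefect S Y (x ++ w) ≡ + 0
  rightDefect-outside S fac Y w w∉S x =
    cong₂ _-_ (∑-zero Y λ y → cong χ (trans (cong S (++-assoc x w y)) (extensions-outside S fac w w∉S x y)))
              (cong χ (trans (cong S (trans (sym (++-identityʳ (x ++ w))) (++-assoc x w [])))
                             (extensions-outside S fac w w∉S x [])))

  defect-outside : ∀ (S : Lang n) → Factorial S → ∀ X Y w → S w ≡ false → defect S X Y w ≡ + 0
  defect-outside S fac X Y w w∉S =
    cong₂ _-_ (∑-zero X (rightDefect-outside S fac Y w w∉S)) (rightDefect-outside S fac Y w w∉S [])

  residual : Fin n → List (Word n) → List (Word n)
  residual a []             = []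
  residual a ([] ∷ ys)      = residual a ys
  residual a ((b ∷ y) ∷ ys) with a ≟ b
  ... | yes _ = y ∷ residual a ys
  ... | no  _ = residual a ys

  residual-∈ : ∀ {a z} Y → z ∈ residual a Y → (a ∷ z) ∈ Y
  residual-∈ ([] ∷ ys) z∈ = there (residual-∈ ys z∈)
  residual-∈ {a} ((b ∷ y) ∷ ys) z∈ with a ≟ b | z∈
  ... | yes refl | here refl = here refl
  ... | yes refl | there z∈′ = there (residual-∈ ys z∈′)
  ... | no  _    | z∈′       = there (residual-∈ ys z∈′)

  ∈-residual : ∀ {a z} Y → (a ∷ z) ∈ Y → z ∈ residual a Y
  ∈-residual ([] ∷ ys) (there az∈) = ∈-residual ys az∈
  ∈-residual {a} ((b ∷ y) ∷ ys) az∈ with a ≟ b | az∈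
  ... | yes refl | here refl   = here refl
  ... | yes refl | there az∈′  = there (∈-residual ys az∈′)
  ... | no  a≢b  | here refl   = ⊥-elim (a≢b refl)
  ... | no  _    | there az∈′  = ∈-residual ys az∈′

  residual-cons : ∀ a b y ys → residual a ((b ∷ y) ∷ ys) ≡ residual a ((b ∷ y) ∷ []) ++ residual a ys
  residual-cons a b y ys with a ≟ b
  ... | yes _ = refl
  ... | no  _ = refl

  residual-self : ∀ b y → residual b ((b ∷ y) ∷ []) ≡ y ∷ []
  residual-self b y with b ≟ b
  ... | yes _   = refl
  ... | no  b≢b = ⊥-elim (b≢b refl)

  residual-other : ∀ {a b} y → a ≢ b → residual a ((b ∷ y) ∷ []) ≡ []
  residual-other {a} {b} y a≢b with a ≟ b
  ... | yes a≡b = ⊥-elim (a≢b a≡b)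
  ... | no  _   = refl

  NonEmptyWords : List (Word n) → Set
  NonEmptyWords Y = ∀ y → y ∈ Y → y ≢ []

  ∑-residuals : (g : Word n → ℤ) (Y : List (Word n)) → NonEmptyWords Y →
    ∑ g Y ≡ ∑ (λ a → ∑ (g ∘ (a ∷_)) (residual a Y)) (allFin n)
  ∑-residuals g []             ε∉Y = sym (∑-zero (allFin n) (λ _ → refl))
  ∑-residuals g ([] ∷ ys)      ε∉Y = ⊥-elim (ε∉Y [] (here refl) refl)
  ∑-residuals g ((b ∷ y) ∷ ys) ε∉Y = begin
    g (b ∷ y) + ∑ g ys
      ≡⟨ cong₂ _+_ (sym (trans (∑-allFin-point first b off) on-b))
                   (∑-residuals g ys (λ z z∈ → ε∉Y z (there z∈))) ⟩
    ∑ first (allFin n) + ∑ rest (allFin n)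
      ≡⟨ sym (∑-distrib-+ first rest (allFin n)) ⟩
    ∑ (λ a → first a + rest a) (allFin n)
      ≡⟨ ∑-cong (allFin n) (λ a → sym (trans (cong (∑ (g ∘ (a ∷_))) (residual-cons a b y ys))
                                              (∑-++ (g ∘ (a ∷_)) (residual a ((b ∷ y) ∷ [])) (residual a ys)))) ⟩
    ∑ (λ a → ∑ (g ∘ (a ∷_)) (residual a ((b ∷ y) ∷ ys))) (allFin n) ∎
    where
    first rest : Fin n → ℤ
    first a = ∑ (g ∘ (a ∷_)) (residual a ((b ∷ y) ∷ []))
    rest  a = ∑ (g ∘ (a ∷_)) (residual a ys)
    off : ∀ a → a ≢ b → first a ≡ + 0
    off a a≢b = cong (∑ (g ∘ (a ∷_))) (residual-other y a≢b)
    on-b : first b ≡ g (b ∷ y)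
    on-b = trans (cong (∑ (g ∘ (b ∷_))) (residual-self b y)) (+-identityʳ _)

  rightDefect-split : ∀ S Y u → NonEmptyWords Y →
    rightDefect S Y u ≡ ∑ (λ a → rightDefect S (residual a Y) (u ++ a ∷ [])) (allFin n) + rightDefect S letters u
  rightDefect-split S Y u ε∉Y = begin
    ∑ (λ y → χ (S (u ++ y))) Y - χ (S u)
      ≡⟨ cong (_- χ (S u)) (trans (∑-residuals _ Y ε∉Y) (∑-cong (allFin n) λ a → ∑-cong (residual a Y) λ z →
            cong (χ ∘ S) (sym (++-assoc u (a ∷ []) z)))) ⟩
    T - χ (S u)
      ≡⟨ sym (+-minus-telescope T Q (χ (S u))) ⟩
    (T - Q) + (Q - χ (S u))
      ≡⟨ cong₂ _+_ (sym (∑-distrib-- _ _ (allFin n)))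
                   (cong (_- χ (S u)) (sym (∑-map (λ y → χ (S (u ++ y))) (_∷ []) (allFin n)))) ⟩
    ∑ (λ a → rightDefect S (residual a Y) (u ++ a ∷ [])) (allFin n) + rightDefect S letters u ∎
    where
    T Q : ℤ
    T = ∑ (λ a → ∑ (λ z → χ (S ((u ++ a ∷ []) ++ z))) (residual a Y)) (allFin n)
    Q = ∑ (λ a → χ (S (u ++ a ∷ []))) (allFin n)

  defect-split : ∀ S X Y w → NonEmptyWords Y →
    defect S X Y w ≡ ∑ (λ a → defect S X (residual a Y) (w ++ a ∷ [])) (allFin n) + defect S X letters w
  defect-split S X Y w ε∉Y = begin
    ∑ (λ x → rightDefect S Y (x ++ w)) X - rightDefect S Y w
      ≡⟨ cong₂ _-_ (∑-cong X (λ x → rightDefect-split S Y (x ++ w) ε∉Y)) (rightDefect-split S Y w ε∉Y) ⟩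
    ∑ (λ x → F (x ++ w) + Dᴬ (x ++ w)) X - (F w + Dᴬ w)
      ≡⟨ cong (_- (F w + Dᴬ w)) (∑-distrib-+ (λ x → F (x ++ w)) (λ x → Dᴬ (x ++ w)) X) ⟩
    (∑ (λ x → F (x ++ w)) X + ∑ (λ x → Dᴬ (x ++ w)) X) - (F w + Dᴬ w)
      ≡⟨ interchange (∑ (λ x → F (x ++ w)) X) (∑ (λ x → Dᴬ (x ++ w)) X) (F w) (Dᴬ w) ⟩
    (∑ (λ x → F (x ++ w)) X - F w) + defect S X letters w
      ≡⟨ cong (λ t → (t - F w) + defect S X letters w) swap ⟩
    (∑ (λ a → ∑ (λ x → Dᵃ a (x ++ w ++ a ∷ [])) X) (allFin n) - F w) + defect S X letters w
      ≡⟨ cong (_+ defect S X letters w) (sym (∑-distrib-- _ _ (allFin n))) ⟩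
    ∑ (λ a → defect S X (residual a Y) (w ++ a ∷ [])) (allFin n) + defect S X letters w ∎
    where
    Dᴬ : Word n → ℤ
    Dᴬ = rightDefect S letters
    Dᵃ : Fin n → Word n → ℤ
    Dᵃ a = rightDefect S (residual a Y)
    F : Word n → ℤ
    F u = ∑ (λ a → Dᵃ a (u ++ a ∷ [])) (allFin n)
    interchange : ∀ p q r s → (p + q) - (r + s) ≡ (p - r) + (q - s)
    interchange = solve-∀
    swap : ∑ (λ x → F (x ++ w)) X ≡ ∑ (λ a → ∑ (λ x → Dᵃ a (x ++ w ++ a ∷ [])) X) (allFin n)
    swap = trans (∑-comm (λ x a → Dᵃ a ((x ++ w) ++ a ∷ [])) X (allFin n))
                 (∑-cong (allFin n) λ a → ∑-cong X λ x → cong (Dᵃ a) (++-assoc x w (a ∷ [])))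

  Comparable : Word n → Word n → Set
  Comparable y v = (∃ λ u → y ++ u ≡ v) ⊎ (∃ λ u → v ++ u ≡ y)

  comparable? : (y v : Word n) → Dec (Comparable y v)
  comparable? []      v       = yes (inj₁ (v , refl))
  comparable? (c ∷ y) []      = yes (inj₂ (c ∷ y , refl))
  comparable? (c ∷ y) (d ∷ v) with c ≟ d | comparable? y v
  ... | no c≢d | _ = no λ { (inj₁ (_ , e)) → c≢d (proj₁ (∷-injective e))
                          ; (inj₂ (_ , e)) → c≢d (sym (proj₁ (∷-injective e))) }
  ... | yes refl | yes (inj₁ (u , e)) = yes (inj₁ (u , cong (c ∷_) e))
  ... | yes refl | yes (inj₂ (u , e)) = yes (inj₂ (u , cong (c ∷_) e))
  ... | yes refl | no ¬cmp = no λ { (inj₁ (u , e)) → ¬cmp (inj₁ (u , proj₂ (∷-injective e)))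
                                  ; (inj₂ (u , e)) → ¬cmp (inj₂ (u , proj₂ (∷-injective e))) }

  Meets : List (Word n) → Word n → Set
  Meets Y v = ∃ λ y → y ∈ Y × Comparable y v

  CoveredAfter : Lang n → List (Word n) → Word n → Set
  CoveredAfter S Y w = ∀ v → S (w ++ v) ≡ true → Meets Y v

  -- Every nonempty word of S meets Y: the combinatorial content of S-maximality.
  RightComplete : Lang n → List (Word n) → Set
  RightComplete S Y = ∀ v → v ≢ [] → S v ≡ true → Meets Y v

  PrefixFree : List (Word n) → Set
  PrefixFree Y = ∀ y₁ y₂ → y₁ ∈ Y → y₂ ∈ Y → ¬ ProperPrefix y₁ y₂

  -- All words of Y have length at most N; the measure of the induction.
  Bounded : ℕ → List (Word n) → Set
  Bounded N Y = All (λ y → length y ≤ N) Y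

  residual-unique : ∀ a Y → Unique Y → Unique (residual a Y)
  residual-unique a []             []          = []
  residual-unique a ([] ∷ ys)      (_ ∷ uys)   = residual-unique a ys uys
  residual-unique a ((b ∷ y) ∷ ys) (y∉ys ∷ uys) with a ≟ b
  ... | yes refl = All.tabulate (λ {z} z∈ y≡z → All.lookup y∉ys (residual-∈ ys z∈) (cong (a ∷_) y≡z))
                   ∷ residual-unique a ys uys
  ... | no  _    = residual-unique a ys uys

  residual-prefixFree : ∀ a Y → PrefixFree Y → PrefixFree (residual a Y)
  residual-prefixFree a Y pfY z₁ z₂ z₁∈ z₂∈ (u , u≢[] , e) =
    pfY (a ∷ z₁) (a ∷ z₂) (residual-∈ Y z₁∈) (residual-∈ Y z₂∈) (u , u≢[] , cong (a ∷_) e)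

  residual-bounded : ∀ N a Y → Bounded (suc N) Y → Bounded N (residual a Y)
  residual-bounded N a Y bY = All.tabulate λ {z} z∈ → shorten {z} (All.lookup bY (residual-∈ Y z∈))
    where
    shorten : ∀ {z} → length (a ∷ z) ≤ suc N → length z ≤ N
    shorten (s≤s le) = le

  residual-covered : ∀ S Y w a → NonEmptyWords Y →
    (∀ v → v ≢ [] → S (w ++ v) ≡ true → Meets Y v) → CoveredAfter S (residual a Y) (w ++ a ∷ [])
  residual-covered S Y w a ε∉Y cov v wav∈S
    with cov (a ∷ v) (λ ()) (trans (cong S (sym (++-assoc w (a ∷ []) v))) wav∈S)
  ... | [] , y∈Y , _ = ⊥-elim (ε∉Y [] y∈Y refl)
  ... | (b ∷ y) , y∈Y , inj₁ (u , e) with ∷-injective e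
  ...   | refl , y++u≡v = y , ∈-residual Y y∈Y , inj₁ (u , y++u≡v)
  residual-covered S Y w a ε∉Y cov v wav∈S | (b ∷ y) , y∈Y , inj₂ (u , e) with ∷-injective e
  ...   | refl , v++u≡y = y , ∈-residual Y y∈Y , inj₂ (u , v++u≡y)

  -- A prefix-free list containing ε is [ε], since ε is a proper prefix of any other word.
  prefixFree-ε : ∀ Y → Unique Y → PrefixFree Y → [] ∈ Y → Y ≡ [] ∷ []
  prefixFree-ε Y uY pfY ε∈Y = only-ε Y uY all-ε ε∈Y
    where
    all-ε : ∀ y → y ∈ Y → y ≡ []
    all-ε []      _   = refl
    all-ε (c ∷ y) y∈Y = ⊥-elim (pfY [] (c ∷ y) ε∈Y y∈Y (c ∷ y , (λ ()) , refl))
    only-ε : ∀ Z → Unique Z → (∀ z → z ∈ Z → z ≡ []) → [] ∈ Z → Z ≡ [] ∷ []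
    only-ε (z ∷ [])      _          z≡ε _ = cong (_∷ []) (z≡ε z (here refl))
    only-ε (z ∷ z′ ∷ zs) (z∉zs ∷ _) z≡ε _ =
      ⊥-elim (All.head z∉zs (trans (z≡ε z (here refl)) (sym (z≡ε z′ (there (here refl))))))

  rightDefect-ε : ∀ S u → rightDefect S ([] ∷ []) u ≡ + 0
  rightDefect-ε S u = begin
    (χ (S (u ++ [])) + + 0) - χ (S u)   ≡⟨ cong (λ t → (χ (S t) + + 0) - χ (S u)) (++-identityʳ u) ⟩
    (χ (S u) + + 0) - χ (S u)           ≡⟨ cong (_- χ (S u)) (+-identityʳ (χ (S u))) ⟩
    χ (S u) - χ (S u)                   ≡⟨ +-inverseʳ (χ (S u)) ⟩
    + 0                                 ∎

  ε∉⇒nonEmptyWords : ∀ {Y} → [] ∉ Y → NonEmptyWords Y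
  ε∉⇒nonEmptyWords {Y} ε∉Y y y∈Y y≡ε = ε∉Y (subst (_∈ Y) y≡ε y∈Y)

  ∷ʳ-nonEmpty : ∀ w (a : Fin n) → w ++ a ∷ [] ≢ []
  ∷ʳ-nonEmpty []      a ()
  ∷ʳ-nonEmpty (_ ∷ _) a ()

  module CodeInvariance (S : Lang n) (fac : Factorial S) (X : List (Word n))
                        (X-balanced : ∀ v → v ≢ [] → defect S X letters v ≡ + 0) where

    defect-vanishes : ∀ N Y w → Bounded N Y → Unique Y → PrefixFree Y →
      CoveredAfter S Y w → w ≢ [] → defect S X Y w ≡ + 0
    defect-vanishes N Y w bY uY pfY covY w≢ε with [] ∈? Y | S w ≟ᵇ true
    ... | yes ε∈Y | _ = begin
      defect S X Y w           ≡⟨ cong (λ Z → defect S X Z w) (prefixFree-ε Y uY pfY ε∈Y) ⟩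
      defect S X ([] ∷ []) w   ≡⟨ cong₂ _-_ (∑-zero X (λ x → rightDefect-ε S (x ++ w))) (rightDefect-ε S w) ⟩
      + 0                      ∎
    ... | no ε∉Y | no w∉S = defect-outside S fac X Y w (¬-not w∉S)
    defect-vanishes zero Y w bY uY pfY covY w≢ε | no ε∉Y | yes w∈S
      with covY [] (trans (cong S (++-identityʳ w)) w∈S)
    ... | [] , ε∈Y , _ = ⊥-elim (ε∉Y ε∈Y)
    ... | (c ∷ y) , y∈Y , _ with All.lookup bY y∈Y
    ...   | ()
    defect-vanishes (suc N) Y w bY uY pfY covY w≢ε | no ε∉Y | yes _ = begin
      defect S X Y w
        ≡⟨ defect-split S X Y w (ε∉⇒nonEmptyWords ε∉Y) ⟩
      ∑ (λ a → defect S X (residual a Y) (w ++ a ∷ [])) (allFin n) + defect S X letters w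
        ≡⟨ cong₂ _+_ (∑-zero (allFin n) vanishes-below) (X-balanced w w≢ε) ⟩
      + 0 ∎
      where
      vanishes-below : ∀ a → defect S X (residual a Y) (w ++ a ∷ []) ≡ + 0
      vanishes-below a = defect-vanishes N (residual a Y) (w ++ a ∷ [])
        (residual-bounded N a Y bY) (residual-unique a Y uY) (residual-prefixFree a Y pfY)
        (residual-covered S Y w a (ε∉⇒nonEmptyWords ε∉Y) (λ v _ → covY v)) (∷ʳ-nonEmpty w a)

    code-invariance : ∀ Y w → NonEmptyWords Y → Unique Y → PrefixFree Y → RightComplete S Y →
      defect S X Y w ≡ defect S X letters w
    code-invariance Y w ε∉Y uY pfY complete = begin
      defect S X Y w
        ≡⟨ defect-split S X Y w ε∉Y ⟩
      ∑ (λ a → defect S X (residual a Y) (w ++ a ∷ [])) (allFin n) + defect S X letters w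
        ≡⟨ cong (_+ defect S X letters w) (∑-zero (allFin n) vanishes-below) ⟩
      + 0 + defect S X letters w
        ≡⟨ +-identityˡ _ ⟩
      defect S X letters w ∎
      where
      N : ℕ
      N = length (argmax length [] Y)
      bY : Bounded (suc N) Y
      bY = All.map m≤n⇒m≤1+n (f[xs]≤f[argmax] [] Y)
      -- Every extension of w in S is in particular a factor in S, hence meets Y.
      covY : ∀ v → v ≢ [] → S (w ++ v) ≡ true → Meets Y v
      covY v v≢ε wv∈S = complete v v≢ε (fac w v [] (trans (cong (λ t → S (w ++ t)) (++-identityʳ v)) wv∈S))
      vanishes-below : ∀ a → defect S X (residual a Y) (w ++ a ∷ []) ≡ + 0
      vanishes-below a = defect-vanishes N (residual a Y) (w ++ a ∷ [])
        (residual-bounded N a Y bY) (residual-unique a Y uY) (residual-prefixFree a Y pfY)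
        (residual-covered S Y w a ε∉Y covY) (∷ʳ-nonEmpty w a)

  member : List (Word n) → Lang n
  member Z z = does (z ∈? Z)

  member-sound : ∀ Z z → member Z z ≡ true → z ∈ Z
  member-sound Z z z∈ with z ∈? Z
  member-sound Z z refl | yes z∈Z = z∈Z

  prefixCode-mono : ∀ {P Q : Word n → Set} → (∀ z → Q z → P z) → IsPrefixCode P → IsPrefixCode Q
  prefixCode-mono Q⊆P (ε∉P , pfP) =
    (λ x qx → ε∉P x (Q⊆P x qx)) , (λ x y qx qy → pfP x y (Q⊆P x qx) (Q⊆P y qy))

  extend-prefixCode : ∀ {Y v} → IsPrefixCode (InList Y) → v ≢ [] →
    ¬ Any (λ y → Comparable y v) Y → IsPrefixCode (InList (v ∷ Y))
  extend-prefixCode {Y} {v} (ε∉Y , pfY) v≢ε none = ε∉vY , pfvY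
    where
    ε∉vY : ∀ x → x ∈ v ∷ Y → x ≢ []
    ε∉vY x (here refl)  = v≢ε
    ε∉vY x (there x∈Y) = ε∉Y x x∈Y
    pfvY : ∀ x y → x ∈ v ∷ Y → y ∈ v ∷ Y → ¬ ProperPrefix x y
    pfvY x y (here refl)  (here refl)  (u , u≢ε , e) = u≢ε (++-identityʳ-unique x (sym e))
    pfvY x y (here refl)  (there y∈Y) (u , _ , e)   = none (lose y∈Y (inj₂ (u , e)))
    pfvY x y (there x∈Y) (here refl)  (u , _ , e)   = none (lose x∈Y (inj₁ (u , e)))
    pfvY x y (there x∈Y) (there y∈Y)               = pfY x y x∈Y y∈Y

  -- An S-maximal prefix code meets every nonempty word of S: otherwise that word
  -- could be added to it, contradicting maximality.
  maximal⇒complete : ∀ S Y → SMaximalPrefixCode S Y → RightComplete S Y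
  maximal⇒complete S Y (codeY , Y⊆S , maximal) v v≢ε v∈S with any? (λ y → comparable? y v) Y
  ... | yes meets = find meets
  ... | no  none  = ⊥-elim (maximal (member (v ∷ Y)) code extension⊆S Y⊆extension
                                    (v , dec-true (v ∈? (v ∷ Y)) (here refl) , v∉Y))
    where
    code : IsPrefixCode (InLang (member (v ∷ Y)))
    code = prefixCode-mono (member-sound (v ∷ Y)) (extend-prefixCode codeY v≢ε none)
    extension⊆S : ∀ z → member (v ∷ Y) z ≡ true → S z ≡ true
    extension⊆S z z∈ with member-sound (v ∷ Y) z z∈
    ... | here refl  = v∈S
    ... | there z∈Y = Y⊆S z z∈Y
    Y⊆extension : ∀ z → z ∈ Y → member (v ∷ Y) z ≡ true
    Y⊆extension z z∈Y = dec-true (z ∈? (v ∷ Y)) (there z∈Y)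
    v∉Y : v ∉ Y
    v∉Y v∈Y = none (lose v∈Y (inj₁ ([] , ++-identityʳ v)))

  rightCode-invariance : ∀ S → Factorial S → ∀ X Y →
    (∀ v → v ≢ [] → S v ≡ true → mXY S X letters v ≡ + 0) →
    Unique Y → SMaximalPrefixCode S Y →
    ∀ w → S w ≡ true → mXY S X Y w ≡ mXY S X letters w
  rightCode-invariance S fac X Y X-balanced uY maxY@((ε∉Y , pfY) , _) w w∈S = begin
    mXY S X Y w           ≡⟨ mXY≡defect S X Y w w∈S ⟩
    defect S X Y w        ≡⟨ code-invariance Y w ε∉Y uY pfY (maximal⇒complete S Y maxY) ⟩
    defect S X letters w  ≡⟨ sym (mXY≡defect S X letters w w∈S) ⟩
    mXY S X letters w     ∎
    where
    balanced : ∀ v → v ≢ [] → defect S X letters v ≡ + 0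
    balanced v v≢ε with S v ≟ᵇ true
    ... | yes v∈S = trans (sym (mXY≡defect S X letters v v∈S)) (X-balanced v v≢ε v∈S)
    ... | no  v∉S = defect-outside S fac X letters v (¬-not v∉S)
    open CodeInvariance S fac X balanced

  mXY-letters : ∀ S w → mXY S letters letters w ≡ m S w
  mXY-letters S w = begin
    ((+ eXY S letters letters w - + ℓX S letters w) - + rY S letters w) + + 1
      ≡⟨ cong₂ (λ e l → ((e - l) - + rY S letters w) + + 1) e≡ (count-map _ _ (_∷ []) (allFin n) λ _ → refl) ⟩
    ((+ e S w - + ℓ S w) - + rY S letters w) + + 1
      ≡⟨ cong (λ r′ → ((+ e S w - + ℓ S w) - r′) + + 1) (count-map _ _ (_∷ []) (allFin n) λ _ → refl) ⟩
    ((+ e S w - + ℓ S w) - + r S w) + + 1 ∎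
    where
    e≡ : + eXY S letters letters w ≡ + e S w
    e≡ = begin
      + eXY S letters letters w
        ≡⟨ count-cartesianProduct _ letters letters ⟩
      ∑ (λ x → ∑ (λ y → χ (S (x ++ w ++ y))) letters) letters
        ≡⟨ trans (∑-map _ (_∷ []) (allFin n)) (∑-cong (allFin n) λ a → ∑-map _ (_∷ []) (allFin n)) ⟩
      ∑ (λ a → ∑ (λ b → χ (S (a ∷ w ++ b ∷ []))) (allFin n)) (allFin n)
        ≡⟨ count-cartesianProduct _ (allFin n) (allFin n) ⟨
      + e S w ∎

  mirror : Lang n → Lang n
  mirror S v = S (reverse v)

  reverse-≢ε : ∀ {x : Word n} → x ≢ [] → reverse x ≢ []
  reverse-≢ε {x} x≢ε rx≡ε = x≢ε (trans (sym (reverse-involutive x)) (cong reverse rx≡ε))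

  reverse-reverse-++ : ∀ (u v : Word n) → reverse (reverse v ++ reverse u) ≡ u ++ v
  reverse-reverse-++ u v =
    trans (reverse-++ (reverse v) (reverse u)) (cong₂ _++_ (reverse-involutive u) (reverse-involutive v))

  reverse-reverse-++-++ : ∀ (x w y : Word n) → reverse (reverse y ++ reverse w ++ reverse x) ≡ x ++ w ++ y
  reverse-reverse-++-++ x w y = begin
    reverse (reverse y ++ reverse w ++ reverse x)   ≡⟨ cong (λ t → reverse (reverse y ++ t)) (reverse-++ x w) ⟨
    reverse (reverse y ++ reverse (x ++ w))         ≡⟨ reverse-reverse-++ (x ++ w) y ⟩
    (x ++ w) ++ y                                   ≡⟨ ++-assoc x w y ⟩
    x ++ w ++ y                                     ∎

  mXY-mirror : ∀ S X Y w →
    mXY S X Y w ≡ mXY (mirror S) (map reverse Y) (map reverse X) (reverse w)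
  mXY-mirror S X Y w = begin
    ((+ eXY S X Y w - + ℓX S X w) - + rY S Y w) + + 1
      ≡⟨ exchange (+ eXY S X Y w) (+ ℓX S X w) (+ rY S Y w) ⟩
    ((+ eXY S X Y w - + rY S Y w) - + ℓX S X w) + + 1
      ≡⟨ cong₂ (λ e l → ((e - l) - + ℓX S X w) + + 1) e≡ r≡ℓ ⟩
    ((+ eXY S̃ Ỹ X̃ w̃ - + ℓX S̃ Ỹ w̃) - + ℓX S X w) + + 1
      ≡⟨ cong (λ r′ → ((+ eXY S̃ Ỹ X̃ w̃ - + ℓX S̃ Ỹ w̃) - r′) + + 1) ℓ≡r ⟩
    ((+ eXY S̃ Ỹ X̃ w̃ - + ℓX S̃ Ỹ w̃) - + rY S̃ X̃ w̃) + + 1 ∎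
    where
    S̃ = mirror S
    X̃ = map reverse X
    Ỹ = map reverse Y
    w̃ = reverse w
    exchange : ∀ e l r → ((e - l) - r) + + 1 ≡ ((e - r) - l) + + 1
    exchange = solve-∀
    ℓ≡r : + ℓX S X w ≡ + rY S̃ X̃ w̃
    ℓ≡r = sym (count-map _ _ reverse X λ x → cong S (reverse-reverse-++ x w))
    r≡ℓ : + rY S Y w ≡ + ℓX S̃ Ỹ w̃
    r≡ℓ = sym (count-map _ _ reverse Y λ y → cong S (reverse-reverse-++ w y))
    e≡ : + eXY S X Y w ≡ + eXY S̃ Ỹ X̃ w̃
    e≡ = begin
      + eXY S X Y w
        ≡⟨ count-cartesianProduct _ X Y ⟩
      ∑ (λ x → ∑ (λ y → χ (S (x ++ w ++ y))) Y) X
        ≡⟨ ∑-comm (λ x y → χ (S (x ++ w ++ y))) X Y ⟩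
      ∑ (λ y → ∑ (λ x → χ (S (x ++ w ++ y))) X) Y
        ≡⟨ ∑-cong Y (λ y → ∑-cong X λ x → cong (χ ∘ S) (sym (reverse-reverse-++-++ x w y))) ⟩
      ∑ (λ y → ∑ (λ x → χ (S̃ (reverse y ++ w̃ ++ reverse x))) X) Y
        ≡⟨ trans (∑-map _ reverse Y) (∑-cong Y λ y → ∑-map _ reverse X) ⟨
      ∑ (λ ỹ → ∑ (λ x̃ → χ (S̃ (ỹ ++ w̃ ++ x̃))) X̃) Ỹ
        ≡⟨ count-cartesianProduct _ Ỹ X̃ ⟨
      + eXY S̃ Ỹ X̃ w̃ ∎

  reverse-++-++ : ∀ (u v w : Word n) → reverse (u ++ v ++ w) ≡ reverse w ++ reverse v ++ reverse u
  reverse-++-++ u v w = begin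
    reverse (u ++ v ++ w)                   ≡⟨ reverse-++ u (v ++ w) ⟩
    reverse (v ++ w) ++ reverse u           ≡⟨ cong (_++ reverse u) (reverse-++ v w) ⟩
    (reverse w ++ reverse v) ++ reverse u   ≡⟨ ++-assoc (reverse w) (reverse v) (reverse u) ⟩
    reverse w ++ reverse v ++ reverse u     ∎

  mirror-factorial : ∀ S → Factorial S → Factorial (mirror S)
  mirror-factorial S fac u v w uvw∈S̃ =
    fac (reverse w) (reverse v) (reverse u) (trans (cong S (sym (reverse-++-++ u v w))) uvw∈S̃)

  suffixCode-reverse : ∀ {P : Word n → Set} → IsSuffixCode P → IsPrefixCode (P ∘ reverse)
  suffixCode-reverse (ε∉P , sfP) =
    (λ x px x≡ε → ε∉P (reverse x) px (cong reverse x≡ε)) ,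
    (λ x y px py (u , u≢ε , x++u≡y) →
      sfP (reverse x) (reverse y) px py (reverse u , reverse-≢ε u≢ε , trans (sym (reverse-++ x u)) (cong reverse x++u≡y)))

  prefixCode-reverse : ∀ {P : Word n → Set} → IsPrefixCode P → IsSuffixCode (P ∘ reverse)
  prefixCode-reverse (ε∉P , pfP) =
    (λ x px x≡ε → ε∉P (reverse x) px (cong reverse x≡ε)) ,
    (λ x y px py (u , u≢ε , u++x≡y) →
      pfP (reverse x) (reverse y) px py (reverse u , reverse-≢ε u≢ε , trans (sym (reverse-++ u x)) (cong reverse u++x≡y)))

  ∈-map-reverse : ∀ {z : Word n} {X} → z ∈ map reverse X → reverse z ∈ X
  ∈-map-reverse {z} {X} z∈ with ∈-map⁻ reverse z∈
  ... | x , x∈X , refl = subst (_∈ X) (sym (reverse-involutive x)) x∈X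

  mirror-maximal : ∀ S X → SMaximalSuffixCode S X → SMaximalPrefixCode (mirror S) (map reverse X)
  mirror-maximal S X (codeX , X⊆S , maximal) =
    prefixCode-mono (λ z → ∈-map-reverse) (suffixCode-reverse codeX) ,
    (λ z z∈ → X⊆S (reverse z) (∈-map-reverse z∈)) ,
    maximal̃
    where
    maximal̃ : ∀ Z → IsPrefixCode (InLang Z) → (∀ z → Z z ≡ true → S (reverse z) ≡ true) →
      (∀ z → z ∈ map reverse X → Z z ≡ true) → ¬ (∃ λ z → Z z ≡ true × z ∉ map reverse X)
    maximal̃ Z codeZ Z⊆S̃ X̃⊆Z (z , z∈Z , z∉X̃) = maximal (Z ∘ reverse) (prefixCode-reverse codeZ)
      (λ x x∈ → subst (λ t → S t ≡ true) (reverse-involutive x) (Z⊆S̃ (reverse x) x∈))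
      (λ x x∈X → X̃⊆Z (reverse x) (∈-map⁺ reverse x∈X))
      (reverse z , subst (λ t → Z t ≡ true) (sym (reverse-involutive z)) z∈Z ,
       λ z̃∈X → z∉X̃ (subst (_∈ map reverse X) (reverse-involutive z) (∈-map⁺ reverse z̃∈X)))

  -- One-letter words are palindromes.
  map-reverse-letters : map reverse letters ≡ letters
  map-reverse-letters = sym (map-∘ (allFin n))

  leftCode-invariance : ∀ S → Factorial S → ∀ X Y →
    (∀ v → v ≢ [] → S v ≡ true → mXY S letters Y v ≡ + 0) →
    Unique X → SMaximalSuffixCode S X →
    ∀ w → S w ≡ true → mXY S X Y w ≡ mXY S letters Y w
  leftCode-invariance S fac X Y Y-balanced uX maxX w w∈S = begin
    mXY S X Y w                   ≡⟨ mXY-mirror S X Y w ⟩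
    mXY S̃ Ỹ (map reverse X) w̃    ≡⟨ rightCode-invariance S̃ (mirror-factorial S fac) Ỹ (map reverse X) balanced
                                      (Unique.map⁺ reverse-injective uX) (mirror-maximal S X maxX) w̃ w̃∈S̃ ⟩
    mXY S̃ Ỹ letters w̃            ≡⟨ mirror-of-letters w ⟨
    mXY S letters Y w             ∎
    where
    S̃ = mirror S
    Ỹ = map reverse Y
    w̃ = reverse w
    w̃∈S̃ : S̃ w̃ ≡ true
    w̃∈S̃ = trans (cong S (reverse-involutive w)) w∈S
    mirror-of-letters : ∀ v → mXY S letters Y v ≡ mXY S̃ Ỹ letters (reverse v)
    mirror-of-letters v = trans (mXY-mirror S letters Y v) (cong (λ L → mXY S̃ Ỹ L (reverse v)) map-reverse-letters)
    balanced : ∀ v → v ≢ [] → S̃ v ≡ true → mXY S̃ Ỹ letters v ≡ + 0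
    balanced v v≢ε v∈S̃ = begin
      mXY S̃ Ỹ letters v                       ≡⟨ cong (mXY S̃ Ỹ letters) (reverse-involutive v) ⟨
      mXY S̃ Ỹ letters (reverse (reverse v))   ≡⟨ mirror-of-letters (reverse v) ⟨
      mXY S letters Y (reverse v)             ≡⟨ Y-balanced (reverse v) (reverse-≢ε v≢ε) v∈S̃ ⟩
      + 0                                     ∎

proposition6 : (n : ℕ) (S : Lang n) (X Y : List (Word n)) →
    Neutral S →
    Unique X → SMaximalSuffixCode S X →
    Unique Y → SMaximalPrefixCode S Y →
    ∀ (w : Word n) → S w ≡ true → mXY S X Y w ≡ m S w
proposition6 n S X Y (fac , neutral) uX maxX uY maxY w w∈S = begin
  mXY S X Y w         ≡⟨ rightCode-invariance S fac X Y X-balanced uY maxY w w∈S ⟩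
  mXY S X letters w   ≡⟨ X-letters w w∈S ⟩
  m S w               ∎
  where
  letters-balanced : ∀ v → v ≢ [] → S v ≡ true → mXY S letters letters v ≡ + 0
  letters-balanced v v≢ε v∈S = trans (mXY-letters S v) (neutral v v≢ε v∈S)
  X-letters : ∀ v → S v ≡ true → mXY S X letters v ≡ m S v
  X-letters v v∈S = trans (leftCode-invariance S fac X letters letters-balanced uX maxX v v∈S) (mXY-letters S v)
  X-balanced : ∀ v → v ≢ [] → S v ≡ true → mXY S X letters v ≡ + 0
  X-balanced v v≢ε v∈S = trans (X-letters v v∈S) (neutral v v≢ε v∈S)
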